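{- Let $\mathsf{M}^*$ be an implicit knowledge-based HMS model with derived explicit possibility correspondences $\Pi^*_i$. For every $i \in I$ and every event $E \in \Sigma$: 1. $A^*_i(E) = A_i(E)$; 2. $K_i(E) = L^*_i(E) \cap A^*_i(E)$.
   Context: Fix a nonempty set $\mathsf{At}$ of atomic formulas. The lattice of spaces: for each $\Phi \subseteq \mathsf{At}$ a nonempty state space $S_\Phi$, pairwise disjoint, ordered by $S_\Psi \preceq S_\Phi$ iff $\Psi \subseteq \Phi$; $\Omega := \bigcup_\Phi S_\Phi$; surjections $r^\Phi_\Psi : S_\Phi \to S_\Psi$ for $\Psi \subseteq \Phi$ with $r^\Phi_\Phi$ the identity and $r^\Phi_\Upsilon = r^\Psi_\Upsilon \circ r^\Phi_\Psi$ for $\Upsilon \subseteq \Psi \subseteq \Phi$. Notation: $\omega_\Psi := r^\Phi_\Psi(\omega)$; $D_\Psi := r^\Phi_\Psi(D)$ for $D \subseteq S_\Phi$, and $D_S := D_\Psi$ for $S = S_\Psi$; $S_\omega$ the space containing $\omega$; $D^{\uparrow} := \bigcup_{\Phi \subseteq \Psi \subseteq \mathsf{At}} (r^\Psi_\Phi)^{ -1}(D)$ for $D \subseteq S_\Phi$. An event is a set $E = D^\uparrow$ with $D \subseteq S_\Phi$, with base-space $S(E) := S_\Phi$; for each $\Phi$ there is a distinct vacuous event $\emptyset^{S_\Phi}$ with base-space $S_\Phi$; $\Sigma$ is the set of events. An implicit knowledge-based HMS model $\langle I, \{S_\Phi\}, (r^\Phi_\Psi), (\Lambda^*_i)_{i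 \in I}, (\alpha_i)_{i \in I}, v\rangle$ has a nonempty set $I$, the lattice, a valuation $v: \mathsf{At} \to \Sigma$, maps $\Lambda^*_i : \Omega \to 2^\Omega \setminus \{\emptyset\}$ satisfying Reflexivity ($\omega \in \Lambda^*_i(\omega)$), Stationarity ($\omega' \in \Lambda^*_i(\omega) \Rightarrow \Lambda^*_i(\omega') = \Lambda^*_i(\omega)$) and Projections Preserve Implicit Knowledge ($\omega \in S_\Phi \Rightarrow \Lambda^*_i(\omega)_\Psi = \Lambda^*_i(\omega_\Psi)$ for all $\Psi \subseteq \Phi$), and awareness functions $\alpha_i : \Omega \to \{S_\Phi\}_{\Phi \subseteq \mathsf{At}}$ satisfying: O. if $\omega \in S_\Phi$ then $\alpha_i(\omega) \preceq S_\Phi$; I. if $\omega' \in \Lambda^*_i(\omega)$ then $\alpha_i(\omega') = \alpha_i(\omega)$; II. if $\omega \in S_\Phi$ and $S_\Psi \preceq \alpha_i(\omega)$ then $\alpha_i(\omega_\Psi) = S_\Psi$; III. if $\omega \in S_\Phi$ and $\alpha_i(\omega) \preceq S_\Psi \preceq S_\Phi$ then $\alpha_i(\omega_\Psi) = \alpha_i(\omega)$; IV. if $\omega \in S_\Phi$ and $\Psi \subseteq \Phi$ then $\alpha_i(\omega) \succeq \alpha_i(\omega_\Psi)$. The derived explicit possibility correspondence is $\Pi^*_i(\omega_\Phi) := \Lambda^*_i(\omega)_{\alpha_i(\omega_\Phi)}$ for all $\omega \in \Omega$ and $\Phi$ with $S_\Phi \preceq S_\omega$; $S_{\Pi^*_i(\omega)}$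 is the space containing $\Pi^*_i(\omega)$. Operators on events $E \in \Sigma$: $A^*_i(E) := \{\omega : \alpha_i(\omega) \succeq S(E)\}$ if nonempty, else $\emptyset^{S(E)}$; $L^*_i(E) := \{\omega : \Lambda^*_i(\omega) \subseteq E\}$ if nonempty, else $\emptyset^{S(E)}$; $K_i(E) := \{\omega : \Pi^*_i(\omega) \subseteq E\}$ if nonempty, else $\emptyset^{S(E)}$; $A_i(E) := \{\omega : S_{\Pi^*_i(\omega)} \succeq S(E)\}$ if nonempty, else $\emptyset^{S(E)}$. -}

module Defs where

open import Level using (0ℓ)
open import Data.Product using (Σ; Σ-syntax; ∃; _×_; _,_; proj₁; proj₂)
open import Relation.Unary using (Pred; _⊆_; _≐_; _∪_; _∩_; Empty)
open import Relation.Binary.PropositionalEquality using (_≡_)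
open import Function.Bundles using (_⇔_)

Sub : Set → Set₁
Sub At = Pred At 0ℓ

-- S Φ is the state space S_Φ; the projection
-- r^Φ_Ψ is indexed by a proof of Ψ ⊆ Φ (the laws are required for all
-- such proofs, so the projection does not depend on the proof).

record Lattice (At : Set) : Set₁ where
  field
    S        : Sub At → Set
    S-ne     : (Φ : Sub At) → S Φ
    r        : {Φ Ψ : Sub At} → Ψ ⊆ Φ → S Φ → S Ψ
    r-surj   : {Φ Ψ : Sub At} (p : Ψ ⊆ Φ) (y : S Ψ) → ∃ λ x → r p x ≡ y
    r-id     : {Φ : Sub At} (p : Φ ⊆ Φ) (x : S Φ) → r p x ≡ x
    r-comp   : {Φ Ψ Υ : Sub At} (p : Ψ ⊆ Φ) (q : Υ ⊆ Ψ) (pq : Υ ⊆ Φ)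
               (x : S Φ) → r pq x ≡ r q (r p x)

  Ω : Set₁
  Ω = Σ (Sub At) S

  Img : {Φ Ψ : Sub At} → Ψ ⊆ Φ → Pred (S Φ) 0ℓ → Pred (S Ψ) 0ℓ
  Img p D y = Σ[ x ∈ _ ] (D x × r p x ≡ y)

  -- Events: E = D↑ with D ⊆ S_base.  (A vacuous event ∅^{S_Φ} is an event
  -- with base Φ and empty D.)
  record Event : Set₁ where
    field
      base : Sub At
      D    : Pred (S base) 0ℓ

  ⟦_⟧ : Event → Pred Ω 0ℓ
  ⟦ E ⟧ (Ψ , ω) = Σ[ p ∈ Event.base E ⊆ Ψ ] Event.D E (r p ω)

  -- Result of an operator of the form
  --   "{ω : P ω} if nonempty, else ∅^{S_B}":
  -- a carrier set together with the base space B.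
  record OpEvent : Set₁ where
    field
      carrier : Pred Ω 0ℓ
      obase   : Sub At

  _≈ᴱ_ : OpEvent → OpEvent → Set₁
  E ≈ᴱ F = (OpEvent.carrier E ≐ OpEvent.carrier F)
         × (Empty (OpEvent.carrier E) → OpEvent.obase E ≐ OpEvent.obase F)

  -- Intersection of events (base space S(E) ∨ S(F) = S_{Φ ∪ Ψ})
  _∩ᴱ_ : OpEvent → OpEvent → OpEvent
  E ∩ᴱ F = record { carrier = OpEvent.carrier E ∩ OpEvent.carrier F
                  ; obase   = OpEvent.obase E ∪ OpEvent.obase F }

-- Implicit knowledge-based HMS model.
-- Λ*_i(ω) is a subset of the space S_ω containing ω (it must lie in one
-- space for its projections to make sense, and contains ω by Reflexivity).
-- α_i(ω) is given by the index Φ of the space S_Φ.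

record HMSModel (At : Set) : Set₂ where
  field
    at₀  : At
    L    : Lattice At
  open Lattice L public
  field
    I    : Set
    i₀   : I
    v    : At → Event
    Λ    : I → {Φ : Sub At} → S Φ → Pred (S Φ) 0ℓ
    α    : I → {Φ : Sub At} → S Φ → Sub At
    Λ-refl : ∀ i {Φ} (ω : S Φ) → Λ i ω ω
    Λ-stat : ∀ i {Φ} (ω ω' : S Φ) → Λ i ω ω' → Λ i ω' ≐ Λ i ω
    Λ-ppik : ∀ i {Φ Ψ} (p : Ψ ⊆ Φ) (ω : S Φ) → Img p (Λ i ω) ≐ Λ i (r p ω)
    α-O   : ∀ i {Φ} (ω : S Φ) → α i ω ⊆ Φ
    α-I   : ∀ i {Φ} (ω ω' : S Φ) → Λ i ω ω' → α i ω' ≐ α i ω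
    α-II  : ∀ i {Φ Ψ} (ω : S Φ) (p : Ψ ⊆ Φ) → Ψ ⊆ α i ω → α i (r p ω) ≐ Ψ
    α-III : ∀ i {Φ Ψ} (ω : S Φ) (p : Ψ ⊆ Φ) → α i ω ⊆ Ψ → α i (r p ω) ≐ α i ω
    α-IV  : ∀ i {Φ Ψ} (ω : S Φ) (p : Ψ ⊆ Φ) → α i (r p ω) ⊆ α i ω

  -- Derived explicit possibility correspondence:
  -- Π*_i(ω) = Λ*_i(ω)_{α_i(ω)}, a subset of the space S_{α_i(ω)}.
  -- (Using ω itself as the lift in the paper's definition.)
  ΠSpace : I → Ω → Sub At
  ΠSpace i (Φ , ω) = α i ω

  Π : (i : I) → (ω : Ω) → Pred (S (ΠSpace i ω)) 0ℓ
  Π i (Φ , ω) = Img (α-O i ω) (Λ i ω)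

  A* : I → Event → OpEvent
  A* i E = record { carrier = λ { (Φ , ω) → Event.base E ⊆ α i ω }
                  ; obase = Event.base E }

  L* : I → Event → OpEvent
  L* i E = record { carrier = λ { (Φ , ω) → ∀ ω' → Λ i ω ω' → ⟦ E ⟧ (Φ , ω') }
                  ; obase = Event.base E }

  K : I → Event → OpEvent
  K i E = record { carrier = λ ω → ∀ y → Π i ω y → ⟦ E ⟧ (ΠSpace i ω , y)
                 ; obase = Event.base E }

  A : I → Event → OpEvent
  A i E = record { carrier = λ ω → Event.base E ⊆ ΠSpace i ω
                 ; obase = Event.base E }

{-# OPTIONS --safe #-}
-- Membership of a state in an event E = D↑ is decided in any space between
-- the base of E and the state's own space.  So an element y = ω'_{α(ω)} of
-- Π*(ω) lies in E exactly when ω' does, provided the agent is aware of the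
-- base of E; awareness of that base is in turn forced by K, since
-- ω_{α(ω)} ∈ Π*(ω) by Reflexivity.
module Submission where

open import Defs
open import Data.Product using (_×_; _,_; proj₁)
open import Data.Sum using (inj₁; reduce)
open import Function using (id; _∘_)
open import Relation.Unary using (_⊆_; _≐_)
open import Relation.Unary.Properties using (≐-refl)
open import Relation.Binary.PropositionalEquality
  using (_≡_; refl; sym; trans; subst; module ≡-Reasoning)

module LatticeFacts {At : Set} (𝓛 : Lattice At) where
  open Lattice 𝓛

  r-irrelevant : ∀ {Φ Ψ} (p q : Ψ ⊆ Φ) (x : S Φ) → r p x ≡ r q x
  r-irrelevant p q x = trans (r-comp id p p x) (sym (r-comp id p q x))

  module _ (E : Event) {Φ Ψ : Sub At} (p : Ψ ⊆ Φ)
           (base⊆Ψ : Event.base E ⊆ Ψ) where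
    open Event E

    ⟦⟧-project : ∀ ω → ⟦ E ⟧ (Φ , ω) → ⟦ E ⟧ (Ψ , r p ω)
    ⟦⟧-project ω (q , d) = base⊆Ψ , subst D base-of-ω d
      where
      open ≡-Reasoning
      base-of-ω : r q ω ≡ r base⊆Ψ (r p ω)
      base-of-ω = begin
        r q ω                  ≡⟨ r-irrelevant q (p ∘ base⊆Ψ) ω ⟩
        r (p ∘ base⊆Ψ) ω       ≡⟨ r-comp p base⊆Ψ (p ∘ base⊆Ψ) ω ⟩
        r base⊆Ψ (r p ω)       ∎

    ⟦⟧-lift : ∀ ω → ⟦ E ⟧ (Ψ , r p ω) → ⟦ E ⟧ (Φ , ω)
    ⟦⟧-lift ω (q , d) = p ∘ q , subst D (sym (r-comp p q (p ∘ q) ω)) d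

  ≈ᴱ-intro : {E F : OpEvent} → OpEvent.carrier E ≐ OpEvent.carrier F →
             OpEvent.obase E ≐ OpEvent.obase F → E ≈ᴱ F
  ≈ᴱ-intro carrier≐ obase≐ = carrier≐ , λ _ → obase≐

  ∩ᴱ-obase-idem : (E F : OpEvent) → OpEvent.obase E ≡ OpEvent.obase F →
                 OpEvent.obase E ≐ OpEvent.obase (E ∩ᴱ F)
  ∩ᴱ-obase-idem E F refl = inj₁ , reduce

module ModelFacts {At : Set} (M : HMSModel At) where
  open HMSModel M
  open LatticeFacts L

  module _ (i : I) (E : Event) where

    K⊆A* : ∀ ω → OpEvent.carrier (K i E) ω → OpEvent.carrier (A* i E) ω
    K⊆A* (Φ , ω) known = proj₁ (known (r (α-O i ω) ω) (ω , Λ-refl i ω , refl))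

    K⊆L* : ∀ ω → OpEvent.carrier (K i E) ω → OpEvent.carrier (L* i E) ω
    K⊆L* (Φ , ω) known ω' ω'∈Λ =
      ⟦⟧-lift E (α-O i ω) (K⊆A* (Φ , ω) known) ω'
        (known (r (α-O i ω) ω') (ω' , ω'∈Λ , refl))

    L*∩A*⊆K : ∀ ω → OpEvent.carrier (L* i E ∩ᴱ A* i E) ω →
              OpEvent.carrier (K i E) ω
    L*∩A*⊆K (Φ , ω) (implicit , aware) _ (ω' , ω'∈Λ , refl) =
      ⟦⟧-project E (α-O i ω) aware ω' (implicit ω' ω'∈Λ)

    K≐L*∩A* : OpEvent.carrier (K i E) ≐ OpEvent.carrier (L* i E ∩ᴱ A* i E)
    K≐L*∩A* = (λ {ω} known → K⊆L* ω known , λ {_} → K⊆A* ω known)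
            , λ {ω} → L*∩A*⊆K ω

proposition5 : {At : Set} (M : HMSModel At) → let open HMSModel M in
    (i : I) (E : Event) → (A* i E ≈ᴱ A i E) × (K i E ≈ᴱ (L* i E ∩ᴱ A* i E))
proposition5 M i E =
    ≈ᴱ-intro ≐-refl ≐-refl
  , ≈ᴱ-intro (K≐L*∩A* i E) (∩ᴱ-obase-idem (K i E) (L* i E) refl)
  where
  open HMSModel M
  open LatticeFacts L
  open ModelFacts M
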